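{- Let $G$ be an infinitely edge-connected graph, let $u,v$ be two distinct vertices of $G$, and let $C$ be a component of $G-u-v$. If $T$ is a finitely separating spanning tree of $\tilde C$ and $t$ is a node of finite degree in $T$, then $C[t]$ (where $t$ is viewed as a subset of $V(C)$) is infinitely edge-connected, and at least one of $u$ and $v$ has infinitely many neighbours in $G$ lying in $t$.
   Context: Graphs are simple and may be infinite. A graph is infinitely edge-connected if no two distinct vertices can be separated by deleting finitely many edges. For a graph $C$, write $x\sim y$ for vertices $x,y$ if no finite edge set separates them in $C$; $\tilde C$ is the graph on the set of $\sim$-classes in which distinct classes $X,Y$ are adjacent iff $C$ has an $X$–$Y$ edge. Nodes of $\tilde C$ are thus vertex sets of $C$. A spanning tree $T$ of $\tilde C$ is finitely separating if for every edge $e\in T$ the set of edges of $\tilde C$ between the vertex sets of the two components of $T-e$ is finite. -}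

module Defs where

open import Level using (0ℓ)
open import Data.Empty using (⊥)
open import Data.Unit using (⊤)
open import Data.Nat using (ℕ)
open import Data.Product using (Σ; Σ-syntax; ∃; ∃-syntax; _×_; _,_)
open import Data.Sum using (_⊎_)
open import Data.List using (List; []; _∷_; _++_)
open import Data.List.Membership.Propositional using (_∈_; _∉_)
open import Data.List.Relation.Unary.Unique.Propositional using (Unique)
open import Data.List.Relation.Unary.Linked using (Linked)
open import Relation.Nullary using (¬_)
open import Relation.Binary.PropositionalEquality using (_≡_; _≢_)
open import Function.Bundles using (_⇔_)

record Graph : Set₁ where
  field
    V     : Set
    E     : V → V → Set
    Esym  : ∀ {x y} → E x y → E y x
    Eirr  : ∀ {x} → ¬ E x x

data Walk {A : Set} (R : A → A → Set) : A → A → Set where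
  []  : ∀ {x} → Walk R x x
  _∷_ : ∀ {x y z} → R x y → Walk R y z → Walk R x z

module _ (G : Graph) where
  open Graph G

  -- A finite edge set of G is given by a list of (ordered) vertex pairs;
  -- the edge xy is deleted if (x,y) or (y,x) is in the list.
  EdgeList : Set
  EdgeList = List (V × V)

  AdjIn : (V → Set) → EdgeList → V → V → Set
  AdjIn S F x y = S x × S y × E x y × ((x , y) ∉ F) × ((y , x) ∉ F)

  InfEdgeConnected : (V → Set) → Set
  InfEdgeConnected S = ∀ x y → S x → S y → (F : EdgeList) → Walk (AdjIn S F) x y

  -- vertex set of the component of G - u - v containing c
  InComp : V → V → V → V → Set
  InComp u v c x = (x ≢ u) × (x ≢ v) × Walk (AdjIn (λ z → (z ≢ u) × (z ≢ v)) []) c x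

  Insep : (V → Set) → V → V → Set
  Insep S x y = (F : EdgeList) → Walk (AdjIn S F) x y

  -- (N , π) is the set of ~-classes of C[S] with its quotient map
  IsClassSet : (S : V → Set) (N : Set) → ((x : V) → S x → N) → Set
  IsClassSet S N π =
    (∀ X → Σ[ x ∈ V ] Σ[ p ∈ S x ] π x p ≡ X) ×
    (∀ x p y q → (π x p ≡ π y q) ⇔ Insep S x y)

  InNode : (S : V → Set) {N : Set} → ((x : V) → S x → N) → N → V → Set
  InNode S π t x = Σ[ p ∈ S x ] π x p ≡ t

  AdjTilde : (S : V → Set) {N : Set} → ((x : V) → S x → N) → N → N → Set
  AdjTilde S π X Y = (X ≢ Y) × (Σ[ x ∈ V ] Σ[ y ∈ V ] InNode S π X x × InNode S π Y y × E x y)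

  InfManyNbrsIn : V → (V → Set) → Set
  InfManyNbrsIn w P = (L : List V) → Σ[ z ∈ V ] E w z × P z × z ∉ L

module _ {N : Set} where

  HasCycle : (N → N → Set) → Set
  HasCycle T = Σ[ x ∈ N ] Σ[ z ∈ N ] Σ[ zs ∈ List N ] Σ[ y ∈ N ]
    Unique (x ∷ z ∷ zs ++ y ∷ []) × Linked T (x ∷ z ∷ zs ++ y ∷ []) × T y x

  IsSpanningTree : (H T : N → N → Set) → Set
  IsSpanningTree H T =
    (∀ {X Y} → T X Y → T Y X) ×
    (∀ {X Y} → T X Y → H X Y) ×
    (∀ X Y → Walk T X Y) ×
    ¬ HasCycle T

  TreeMinus : (T : N → N → Set) → N → N → N → N → Set
  TreeMinus T a b X Y = T X Y × ¬ (((X ≡ a) × (Y ≡ b)) ⊎ ((X ≡ b) × (Y ≡ a)))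

  FinitelySeparating : (H T : N → N → Set) → Set
  FinitelySeparating H T =
    ∀ a b → T a b → Σ[ L ∈ List (N × N) ]
      (∀ X Y → Walk (TreeMinus T a b) a X → Walk (TreeMinus T a b) b Y →
         H X Y → (X , Y) ∈ L)

  FiniteDegree : (T : N → N → Set) → N → Set
  FiniteDegree T t = Σ[ L ∈ List N ] (∀ Y → T t Y → Y ∈ L)

-- Let D be the finite set of edges of C obtained by choosing, for every one of the finitely
-- many edges ts of T at t and every edge tY of C~ across T - ts (finitely many by finite
-- separation), a finite edge set separating the classes t and Y.  An edge ab of C from t to
-- another class Y gives an edge tY of C~ across T - ts, where s is the neighbour through which
-- the tree path from t to Y leaves t; the chosen separator of t and Y must contain ab, so ab
-- lies in D and the class t is closed in C - D.  Hence a walk in C - (F ∪ D) between two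
-- vertices of t, which exists because they are ~-equivalent, never leaves t, so C[t] is
-- infinitely edge-connected.  If u and v both had only finitely many neighbours in t,
-- deleting those edges together with D would leave t closed in all of G, and finitely many
-- edges would separate u from t.
module Submission where

open import Defs
open import Level using (0ℓ)
open import Axiom.ExcludedMiddle using (ExcludedMiddle)
open import Axiom.DoubleNegationElimination using (DoubleNegationElimination; em⇒dne)
open import Data.Product using (_×_; Σ; Σ-syntax; ∃; _,_; proj₁; proj₂; uncurry)
open import Data.Sum using (_⊎_; inj₁; inj₂)
open import Data.Unit using (⊤; tt)
open import Data.Empty using (⊥; ⊥-elim)
open import Data.List using (List; []; _∷_; _++_; map; concatMap)
open import Data.List.Membership.Propositional using (_∈_; lose)
open import Data.List.Membership.Propositional.Properties
  using (∈-++⁺ˡ; ∈-++⁺ʳ; ∈-map⁺; ∈-concatMap⁺)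
open import Function using (_∘_)
open import Function.Bundles using (Equivalence)
open import Relation.Nullary using (¬_; Dec; yes; no)
open import Relation.Binary.Definitions using (DecidableEquality)
open import Relation.Binary.PropositionalEquality using (_≢_; refl; sym; trans)

private variable
  A N : Set

_◅◅_ : {R : A → A → Set} {x y z : A} → Walk R x y → Walk R y z → Walk R x z
[] ◅◅ w′ = w′
(e ∷ w) ◅◅ w′ = e ∷ (w ◅◅ w′)

Walk-map : {R Q : A → A → Set} → (∀ {x y} → R x y → Q x y) → ∀ {x y} → Walk R x y → Walk Q x y
Walk-map f [] = []
Walk-map f (e ∷ w) = f e ∷ Walk-map f w

Closed : (A → A → Set) → (A → Set) → Set
Closed R P = ∀ {x y} → P x → R x y → P y

Walk-closed : {R : A → A → Set} {P : A → Set} → Closed R P → ∀ {x y} → P x → Walk R x y → P y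
Walk-closed closed Px [] = Px
Walk-closed closed Px (e ∷ w) = Walk-closed closed (closed Px e) w

¬∀⇒∃¬ : DoubleNegationElimination 0ℓ → {P : A → Set} → ¬ (∀ x → P x) → ∃ λ x → ¬ P x
¬∀⇒∃¬ dne ¬∀ = dne λ ¬∃ → ¬∀ λ x → dne λ ¬Px → ¬∃ (x , ¬Px)

choose-if : {P : Set} {R : A → Set} → A → Dec P → (P → Σ A R) → Σ[ x ∈ A ] (P → R x)
choose-if a (yes p) f = proj₁ (f p) , λ _ → proj₂ (f p)
choose-if a (no ¬p) f = a , λ p → ⊥-elim (¬p p)

module _ {T : N → N → Set} (_≟_ : DecidableEquality N) (t : N) where

  Avoiding : N → N → Set
  Avoiding a b = T a b × a ≢ t × b ≢ t

  last-visit : ∀ {z Y} → Walk T z Y → Y ≢ t →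
    (Σ[ s ∈ N ] T t s × Walk Avoiding s Y) ⊎ (z ≢ t × Walk Avoiding z Y)
  last-visit [] Y≢t = inj₂ (Y≢t , [])
  last-visit {z} (_∷_ {y = z′} e w) Y≢t with last-visit w Y≢t | z ≟ t
  ... | inj₁ exit         | _        = inj₁ exit
  ... | inj₂ (z′≢t , w′) | yes refl = inj₁ (z′ , e , w′)
  ... | inj₂ (z′≢t , w′) | no z≢t   = inj₂ (z≢t , (e , z≢t , z′≢t) ∷ w′)

  Avoiding⇒TreeMinus : ∀ {s a b} → Avoiding a b → TreeMinus T t s a b
  Avoiding⇒TreeMinus (e , a≢t , b≢t) = e , λ
    { (inj₁ (a≡t , _)) → a≢t a≡t
    ; (inj₂ (_ , b≡t)) → b≢t b≡t }

  last-exit : ∀ {Y} → Walk T t Y → Y ≢ t → Σ[ s ∈ N ] T t s × Walk (TreeMinus T t s) s Y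
  last-exit w Y≢t with last-visit w Y≢t
  ... | inj₁ (s , e , w′) = s , e , Walk-map Avoiding⇒TreeMinus w′
  ... | inj₂ (t≢t , _)    = ⊥-elim (t≢t refl)

module _ (G : Graph) where
  open Graph G

  InComp-extend : ∀ {u v c a b} → InComp G u v c a → E a b → b ≢ u → b ≢ v → InComp G u v c b
  InComp-extend (a≢u , a≢v , w) e b≢u b≢v =
    b≢u , b≢v , w ◅◅ (((a≢u , a≢v) , (b≢u , b≢v) , e , (λ ()) , (λ ())) ∷ [])

  finite-neighbours : DoubleNegationElimination 0ℓ → ∀ {w P} → ¬ InfManyNbrsIn G w P →
    Σ[ L ∈ List V ] (∀ {z} → E w z → P z → z ∈ L)
  finite-neighbours dne ¬inf with ¬∀⇒∃¬ dne ¬inf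
  ... | L , no-new = L , λ e Pz → dne λ z∉L → no-new (_ , e , Pz , z∉L)

  module _ {S P : V → Set} {D : EdgeList G} (P-closed : Closed (AdjIn G S D) P) where

    restrict-walk : ∀ {F a b} → P a → Walk (AdjIn G S (F ++ D)) a b → Walk (AdjIn G P F) a b
    restrict-walk Pa [] = []
    restrict-walk {F} Pa (_∷_ {y = b} (Sa , Sb , e , ab∉ , ba∉) w) =
      (Pa , Pb , e , ab∉ ∘ ∈-++⁺ˡ , ba∉ ∘ ∈-++⁺ˡ) ∷ restrict-walk Pb w
      where
        Pb : P b
        Pb = P-closed Pa (Sa , Sb , e , ab∉ ∘ ∈-++⁺ʳ F , ba∉ ∘ ∈-++⁺ʳ F)

    closed-Insep⇒InfEdgeConnected :
      (∀ {x y} → P x → P y → Insep G S x y) → InfEdgeConnected G P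
    closed-Insep⇒InfEdgeConnected insep x y Px Py F = restrict-walk Px (insep Px Py (F ++ D))

  closed-in-component⇒InfManyNbrs : ExcludedMiddle 0ℓ → InfEdgeConnected G (λ _ → ⊤) →
    ∀ {u v c} {P : V → Set} {D : EdgeList G} →
    (∀ {x} → P x → InComp G u v c x) → Closed (AdjIn G (InComp G u v c) D) P → ∃ P →
    InfManyNbrsIn G u P ⊎ InfManyNbrsIn G v P
  closed-in-component⇒InfManyNbrs em G-iec {u} {v} {c} {P} {D} P⊆C P-closed (x , Px)
    with em {InfManyNbrsIn G u P} | em {InfManyNbrsIn G v P}
  ... | yes inf | _       = inj₁ inf
  ... | no _    | yes inf = inj₂ inf
  ... | no ¬inf-u | no ¬inf-v =
    ⊥-elim (proj₁ (P⊆C (Walk-closed P-closed-in-G Px (G-iec x u tt tt F))) refl)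
    where
      Nu : Σ[ L ∈ List V ] (∀ {z} → E u z → P z → z ∈ L)
      Nu = finite-neighbours (em⇒dne em) ¬inf-u
      Nv : Σ[ L ∈ List V ] (∀ {z} → E v z → P z → z ∈ L)
      Nv = finite-neighbours (em⇒dne em) ¬inf-v
      Fu Fv F : EdgeList G
      Fu = map (u ,_) (proj₁ Nu)
      Fv = map (v ,_) (proj₁ Nv)
      F = Fu ++ Fv ++ D

      P-closed-in-G : Closed (AdjIn G (λ _ → ⊤) F) P
      P-closed-in-G {a} {b} Pa (_ , _ , e , ab∉ , ba∉) =
        P-closed Pa (P⊆C Pa , Cb , e , ab∉ ∘ ∈-++⁺ʳ Fu ∘ ∈-++⁺ʳ Fv , ba∉ ∘ ∈-++⁺ʳ Fu ∘ ∈-++⁺ʳ Fv)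
        where
          b≢u : b ≢ u
          b≢u refl = ba∉ (∈-++⁺ˡ (∈-map⁺ (u ,_) (proj₂ Nu (Esym e) Pa)))
          b≢v : b ≢ v
          b≢v refl = ba∉ (∈-++⁺ʳ Fu (∈-++⁺ˡ (∈-map⁺ (v ,_) (proj₂ Nv (Esym e) Pa))))
          Cb : InComp G u v c b
          Cb = InComp-extend (P⊆C Pa) e b≢u b≢v

  module _ {S : V → Set} {N : Set} {π : (x : V) → S x → N} (cls : IsClassSet G S N π) where

    same-node⇒Insep : ∀ {X a b} → InNode G S π X a → InNode G S π X b → Insep G S a b
    same-node⇒Insep {a = a} {b} (p , πa≡X) (q , πb≡X) =
      Equivalence.to (proj₂ cls a p b q) (trans πa≡X (sym πb≡X))

    Separates : EdgeList G → N → N → Set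
    Separates F X Y = ∀ {a b} → InNode G S π X a → InNode G S π Y b → ¬ Walk (AdjIn G S F) a b

    module _ (em : ExcludedMiddle 0ℓ) where

      separator-exists : ∀ {X Y} → X ≢ Y → Σ[ F ∈ EdgeList G ] Separates F X Y
      separator-exists {X} {Y} X≢Y with proj₁ cls X | proj₁ cls Y
      ... | x , x∈X | y , y∈Y = F , λ a∈X b∈Y w →
        no-walk (same-node⇒Insep x∈X a∈X F ◅◅ (w ◅◅ same-node⇒Insep b∈Y y∈Y F))
        where
          ¬insep : ¬ Insep G S x y
          ¬insep xy = X≢Y (trans (sym (proj₂ x∈X))
            (trans (Equivalence.from (proj₂ cls x _ y _) xy) (proj₂ y∈Y)))
          F : EdgeList G
          F = proj₁ (¬∀⇒∃¬ (em⇒dne em) ¬insep)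
          no-walk : ¬ Walk (AdjIn G S F) x y
          no-walk = proj₂ (¬∀⇒∃¬ (em⇒dne em) ¬insep)

      separating : ∀ X Y → Σ[ F ∈ EdgeList G ] (X ≢ Y → Separates F X Y)
      separating X Y = choose-if [] em separator-exists

      separator : N → N → EdgeList G
      separator X Y = proj₁ (separating X Y)

      module _ {T : N → N → Set} (T-connected : ∀ X Y → Walk T X Y)
               (T-fs : FinitelySeparating (AdjTilde G S π) T) {t : N} (t-deg : FiniteDegree T t) where

        crossing : ∀ s → Σ[ L ∈ List (N × N) ]
          (T t s → ∀ Y → Walk (TreeMinus T t s) s Y → AdjTilde G S π t Y → (t , Y) ∈ L)
        crossing s = choose-if [] em λ ts →
          proj₁ (T-fs t s ts) , λ Y w tY → proj₂ (T-fs t s ts) t Y [] w tY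

        cut : EdgeList G
        cut = concatMap (λ s → concatMap (uncurry separator) (proj₁ (crossing s))) (proj₁ t-deg)

        separator⊆cut : ∀ {s Y} → T t s → (t , Y) ∈ proj₁ (crossing s) →
          ∀ {e} → e ∈ separator t Y → e ∈ cut
        separator⊆cut ts tY∈ e∈ =
          ∈-concatMap⁺ _ (lose (proj₂ t-deg _ ts) (∈-concatMap⁺ (uncurry separator) (lose tY∈ e∈)))

        cut-closes-node : Closed (AdjIn G S cut) (InNode G S π t)
        cut-closes-node {a} {b} a∈t (_ , Sb , e , ab∉ , ba∉) = Sb , em⇒dne em b-stays
          where
            b-stays : π b Sb ≢ t → ⊥
            b-stays b∉t with last-exit (λ _ _ → em) t (T-connected t (π b Sb)) b∉t
            ... | s , ts , w = proj₂ (separating t (π b Sb)) t≢Y a∈t (Sb , refl) (edge ∷ [])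
              where
                t≢Y : t ≢ π b Sb
                t≢Y = b∉t ∘ sym
                tY∈ : (t , π b Sb) ∈ proj₁ (crossing s)
                tY∈ = proj₂ (crossing s) ts (π b Sb) w (t≢Y , a , b , a∈t , (Sb , refl) , e)
                edge : AdjIn G S (separator t (π b Sb)) a b
                edge = proj₁ a∈t , Sb , e , ab∉ ∘ separator⊆cut ts tY∈ , ba∉ ∘ separator⊆cut ts tY∈

lemma5p7 : ExcludedMiddle 0ℓ → (G : Graph) →
    InfEdgeConnected G (λ _ → ⊤) →
    (u v : Graph.V G) → u ≢ v →
    (c : Graph.V G) → c ≢ u → c ≢ v →
    (N : Set) (π : (x : Graph.V G) → InComp G u v c x → N) →
    IsClassSet G (InComp G u v c) N π →
    (T : N → N → Set) →
    IsSpanningTree (AdjTilde G (InComp G u v c) π) T →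
    FinitelySeparating (AdjTilde G (InComp G u v c) π) T →
    (t : N) → FiniteDegree T t →
    InfEdgeConnected G (InNode G (InComp G u v c) π t) ×
    (InfManyNbrsIn G u (InNode G (InComp G u v c) π t) ⊎
    InfManyNbrsIn G v (InNode G (InComp G u v c) π t))
lemma5p7 em G G-iec u v _ c _ _ N π cls T (_ , _ , T-connected , _) T-fs t t-deg =
  closed-Insep⇒InfEdgeConnected G t-closed (same-node⇒Insep G cls) ,
  closed-in-component⇒InfManyNbrs G em G-iec proj₁ t-closed (proj₁ cls t)
  where
    t-closed : Closed (AdjIn G (InComp G u v c) (cut G cls em T-connected T-fs t-deg))
                      (InNode G (InComp G u v c) π t)
    t-closed = cut-closes-node G cls em T-connected T-fs t-deg
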